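{- Let $r, s$ be complex numbers and let $g(x)$ be the unique formal power series satisfying $$g(x) = \frac{1}{1 - \frac{1 + r x}{1 - x}\, x - s x^2 g(x)}.$$ Then $\{H_n(g)\}_{n \ge 1}$ is a $(0,\ s^2(r+s+1)^2)$ Somos 4 sequence, i.e. for all $n \ge 5$, $$H_n(g) H_{n-4}(g) = s^2 (r+s+1)^2\, H_{n-2}(g)^2 .$$
   Context: For a formal power series $A(x) = \sum_{n\ge 0} a_n x^n$, $H_n(A) = \det\big(a_{i+j}\big)_{0 \le i,j \le n-1}$, with $H_0(A) = 1$. A sequence $(t_n)_{n\ge 1}$ is an $(\alpha,\beta)$ Somos 4 sequence if $t_n t_{n-4} = \alpha t_{n-1} t_{n-3} + \beta t_{n-2}^2$ for every $n$ for which all indices are in range (equivalently $t_n = (\alpha t_{n-1}t_{n-3} + \beta t_{n-2}^2)/t_{n-4}$). -}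

module Defs where

open import Level using (Level)
open import Data.Nat using (ℕ; zero; suc; _∸_; _≤_) renaming (_+_ to _+ℕ_)
open import Data.Fin using (Fin; zero; suc; toℕ; punchIn)
open import Algebra.Bundles using (CommutativeRing)

module _ {c ℓ : Level} (R : CommutativeRing c ℓ) where
  open CommutativeRing R using (Carrier; _≈_; _+_; _*_; -_; _-_; 0#; 1#)

  PS : Set c
  PS = ℕ → Carrier

  sumTo : (ℕ → Carrier) → ℕ → Carrier
  sumTo f zero    = 0#
  sumTo f (suc n) = f n + sumTo f n

  _≋_ : PS → PS → Set ℓ
  A ≋ B = ∀ n → A n ≈ B n

  _⊕_ : PS → PS → PS
  (A ⊕ B) n = A n + B n

  _⊖_ : PS → PS → PS
  (A ⊖ B) n = A n - B n

  _·_ : Carrier → PS → PS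
  (a · A) n = a * A n

  _⋆_ : PS → PS → PS
  (A ⋆ B) n = sumTo (λ k → A k * B (n ∸ k)) (suc n)

  oneS : PS
  oneS zero    = 1#
  oneS (suc _) = 0#

  xS : PS
  xS zero          = 0#
  xS (suc zero)    = 1#
  xS (suc (suc _)) = 0#

  -- 1/(1 - x) = Σ x^n
  geoS : PS
  geoS _ = 1#

  -- g satisfies g = 1 / (1 - (1 + r x)/(1 - x) · x - s x^2 g),
  -- i.e. g · (1 - (1 + r x)(1/(1-x)) x - s x^2 g) = 1
  SatisfiesEq : Carrier → Carrier → PS → Set ℓ
  SatisfiesEq r s g =
    (g ⋆ ((oneS ⊖ (((oneS ⊕ (r · xS)) ⋆ geoS) ⋆ xS)) ⊖ (s · ((xS ⋆ xS) ⋆ g)))) ≋ oneS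

  sumFin : ∀ {n} → (Fin n → Carrier) → Carrier
  sumFin {zero}  f = 0#
  sumFin {suc n} f = f zero + sumFin (λ i → f (suc i))

  negOnePow : ℕ → Carrier
  negOnePow zero    = 1#
  negOnePow (suc k) = - negOnePow k

  det : ∀ n → (Fin n → Fin n → Carrier) → Carrier
  det zero    M = 1#
  det (suc n) M =
    sumFin (λ j → negOnePow (toℕ j) * (M zero j * det n (λ i k → M (suc i) (punchIn j k))))

  Hankel : ℕ → PS → Carrier
  Hankel n A = det n (λ i j → A (toℕ i +ℕ toℕ j))

  IsSomos4 : Carrier → Carrier → (ℕ → Carrier) → Set ℓ
  IsSomos4 α β t = ∀ n → 5 ≤ n →
    t n * t (n ∸ 4) ≈ α * (t (n ∸ 1) * t (n ∸ 3)) + β * (t (n ∸ 2) * t (n ∸ 2))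

-- The functional equation says that g is the generating function of the J-fraction whose
-- b-weights are all 1 and whose λ-weights alternate r + s + 1, s, r + s + 1, s, …, so g n
-- counts weighted Motzkin paths.  For such a moment sequence the Hankel determinant is
-- H_n = ∏_{j<n} λ_1 ⋯ λ_j: multiplying the Hankel matrix by the unitriangular coefficient
-- matrix of the monic orthogonal polynomials of the J-fraction leaves its determinant
-- unchanged and makes it lower triangular with diagonal λ_1 ⋯ λ_j.  Consecutive weights
-- multiply to s (r + s + 1), so H_{n+4} H_n / H_{n+2}² = s² (r + s + 1)².
module Submission where

open import Level using (Level)
open import Algebra.Bundles using (CommutativeRing)
open import Data.Empty using (⊥-elim)
open import Data.Fin as Fin using (Fin; zero; suc; toℕ; punchIn; punchOut; fromℕ<)
open import Data.Fin.Permutation.Components using (transpose)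
import Data.Fin.Properties as Finₚ
open import Data.Nat as ℕ using (ℕ; zero; suc; _∸_; z≤n; s≤s)
  renaming (_+_ to _+ℕ_; _<_ to _<ℕ_; _≤_ to _≤ℕ_)
import Data.Nat.Properties as ℕₚ
open import Data.Product using (_,_; _×_; proj₂)
open import Data.Sum using (_⊎_; inj₁; inj₂)
open import Function using (_∘_)
open import Relation.Binary.Definitions using (tri<; tri≈; tri>)
open import Relation.Binary.PropositionalEquality as ≡ using (_≡_; _≢_)
open import Relation.Nullary using (Dec; yes; no; ¬_)
open import Defs

Adjacent : ∀ {n} → Fin n → Fin n → Set
Adjacent c d = toℕ d ≡ suc (toℕ c)

adjacent⇒≢ : ∀ {n} {c d : Fin n} → Adjacent c d → c ≢ d
adjacent⇒≢ d≡1+c c≡d = ℕₚ.1+n≢n (≡.trans (≡.sym d≡1+c) (≡.cong toℕ (≡.sym c≡d)))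

punchIn-adjacent : ∀ {n} (c d : Fin (suc n)) (k : Fin n) → Adjacent c d →
  punchIn c k ≡ punchIn d k ⊎ (punchIn c k ≡ d × punchIn d k ≡ c)
punchIn-adjacent zero (suc zero) zero _ = inj₂ (≡.refl , ≡.refl)
punchIn-adjacent zero (suc zero) (suc k) _ = inj₁ ≡.refl
punchIn-adjacent {suc n} (suc c) (suc d) zero _ = inj₁ ≡.refl
punchIn-adjacent {suc n} (suc c) (suc d) (suc k) d≡1+c
  with punchIn-adjacent c d k (ℕₚ.suc-injective d≡1+c)
... | inj₁ same = inj₁ (≡.cong suc same)
... | inj₂ (c↦d , d↦c) = inj₂ (≡.cong suc c↦d , ≡.cong suc d↦c)

punchOut-adjacent : ∀ {n} {j c d : Fin (suc n)} (j≢c : j ≢ c) (j≢d : j ≢ d) →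
  Adjacent c d → Adjacent (punchOut j≢c) (punchOut j≢d)
punchOut-adjacent {j = zero} {zero} j≢c _ _ = ⊥-elim (j≢c ≡.refl)
punchOut-adjacent {j = zero} {suc c} {suc d} _ _ d≡1+c = ℕₚ.suc-injective d≡1+c
punchOut-adjacent {suc n} {suc zero} {zero} {suc zero} _ j≢d _ = ⊥-elim (j≢d ≡.refl)
punchOut-adjacent {suc (suc n)} {suc (suc j)} {zero} {suc zero} _ _ _ = ≡.refl
punchOut-adjacent {suc n} {suc j} {suc c} {suc d} j≢c j≢d d≡1+c =
  ≡.cong suc (punchOut-adjacent (j≢c ∘ ≡.cong suc) (j≢d ∘ ≡.cong suc) (ℕₚ.suc-injective d≡1+c))

transpose-matchˡ : ∀ {n} (c d : Fin n) → transpose c d c ≡ d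
transpose-matchˡ c d with c Fin.≟ c
... | yes _   = ≡.refl
... | no  c≢c = ⊥-elim (c≢c ≡.refl)

transpose-matchʳ : ∀ {n} (c d : Fin n) → transpose c d d ≡ c
transpose-matchʳ c d with d Fin.≟ c
... | yes ≡.refl = ≡.refl
... | no  _ with d Fin.≟ d
...   | yes _   = ≡.refl
...   | no  d≢d = ⊥-elim (d≢d ≡.refl)

transpose-other : ∀ {n} {c d j : Fin n} → j ≢ c → j ≢ d → transpose c d j ≡ j
transpose-other {c = c} {d} {j} j≢c j≢d with j Fin.≟ c
... | yes j≡c = ⊥-elim (j≢c j≡c)
... | no  _ with j Fin.≟ d
...   | yes j≡d = ⊥-elim (j≢d j≡d)
...   | no  _   = ≡.refl

n∸m≡1+[n∸1+m] : ∀ {m n} → m <ℕ n → n ∸ m ≡ suc (n ∸ suc m)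
n∸m≡1+[n∸1+m] {n = suc n} (s≤s m≤n) = ℕₚ.+-∸-assoc 1 m≤n

module _ {ℓ₁ ℓ₂ : Level} (R : CommutativeRing ℓ₁ ℓ₂) where
  open CommutativeRing R hiding (zero)
  open import Algebra.Properties.Ring ring
    using (-0#≈0#; -‿+-comm; -‿distribˡ-*; -‿distribʳ-*; x∙y⁻¹≈ε⇒x≈y; //-rightDividesʳ; x[y-z]≈xy-xz)
  open import Algebra.Properties.Semiring.Sum semiring
    using (sum; sum-cong-≋; ∑-distrib-+; *-distribˡ-sum; sum-remove; sum-replicate-zero)
  open import Algebra.Properties.Monoid.Sum *-monoid using ()
    renaming (sum to product; sum-cong-≋ to product-cong; sum-cong-≗ to product-cong-≗; sum-init-last to product-init-last)
  open import Algebra.Solver.Ring.NaturalCoefficients.Default commutativeSemiring using (solve; _:+_; _:*_; _:=_)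
  open import Relation.Binary.Reasoning.Setoid setoid

  -- Finite sums

  sumTo-cong : ∀ {f h : ℕ → Carrier} n → (∀ i → i <ℕ n → f i ≈ h i) → sumTo R f n ≈ sumTo R h n
  sumTo-cong zero    f≈h = refl
  sumTo-cong (suc n) f≈h = +-cong (f≈h n ℕₚ.≤-refl) (sumTo-cong n (λ i i<n → f≈h i (ℕₚ.m<n⇒m<1+n i<n)))

  sumTo-zero : ∀ {f : ℕ → Carrier} n → (∀ i → i <ℕ n → f i ≈ 0#) → sumTo R f n ≈ 0#
  sumTo-zero zero    f≈0 = refl
  sumTo-zero (suc n) f≈0 =
    trans (+-cong (f≈0 n ℕₚ.≤-refl) (sumTo-zero n (λ i i<n → f≈0 i (ℕₚ.m<n⇒m<1+n i<n)))) (+-identityʳ 0#)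

  sumTo-distrib-+ : ∀ (f h : ℕ → Carrier) n → sumTo R (λ i → f i + h i) n ≈ sumTo R f n + sumTo R h n
  sumTo-distrib-+ f h zero    = sym (+-identityʳ 0#)
  sumTo-distrib-+ f h (suc n) = trans (+-congˡ (sumTo-distrib-+ f h n)) (+-medial (f n) (h n) _ _)
    where
    +-medial : ∀ a b x y → (a + b) + (x + y) ≈ (a + x) + (b + y)
    +-medial = solve 4 (λ a b x y → (a :+ b) :+ (x :+ y) := (a :+ x) :+ (b :+ y)) refl

  *-distribˡ-sumTo : ∀ a (f : ℕ → Carrier) n → a * sumTo R f n ≈ sumTo R (λ i → a * f i) n
  *-distribˡ-sumTo a f zero    = zeroʳ a
  *-distribˡ-sumTo a f (suc n) = trans (distribˡ a (f n) _) (+-congˡ (*-distribˡ-sumTo a f n))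

  -‿distrib-sumTo : ∀ (f : ℕ → Carrier) n → - sumTo R f n ≈ sumTo R (λ i → - f i) n
  -‿distrib-sumTo f zero    = -0#≈0#
  -‿distrib-sumTo f (suc n) = trans (sym (-‿+-comm (f n) _)) (+-congˡ (-‿distrib-sumTo f n))

  sumTo-head : ∀ (f : ℕ → Carrier) n → sumTo R f (suc n) ≈ f 0 + sumTo R (f ∘ suc) n
  sumTo-head f zero    = refl
  sumTo-head f (suc n) = trans (+-congˡ (sumTo-head f n)) (x+[y+z]≈y+[x+z] (f (suc n)) (f 0) _)
    where
    x+[y+z]≈y+[x+z] : ∀ x y z → x + (y + z) ≈ y + (x + z)
    x+[y+z]≈y+[x+z] = solve 3 (λ x y z → x :+ (y :+ z) := y :+ (x :+ z)) refl

  sumTo-reverse : ∀ (f : ℕ → Carrier) n → sumTo R f n ≈ sumTo R (λ i → f (n ∸ suc i)) n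
  sumTo-reverse f zero    = refl
  sumTo-reverse f (suc n) =
    trans (+-congˡ (sumTo-reverse f n)) (sym (sumTo-head (λ i → f (suc n ∸ suc i)) n))

  sumTo-select : ∀ {f : ℕ → Carrier} n p → p <ℕ n →
                 (∀ i → i <ℕ n → i ≢ p → f i ≈ 0#) → sumTo R f n ≈ f p
  sumTo-select (suc n) p p<1+n f≈0 with n ℕ.≟ p
  ... | yes ≡.refl = trans (+-congˡ (sumTo-zero n (λ i i<n → f≈0 i (ℕₚ.m<n⇒m<1+n i<n) (ℕₚ.<⇒≢ i<n))))
                           (+-identityʳ _)
  ... | no n≢p = trans (+-cong (f≈0 n ℕₚ.≤-refl n≢p) (sumTo-select n p p<n (λ i i<n → f≈0 i (ℕₚ.m<n⇒m<1+n i<n))))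
                       (+-identityˡ _)
    where
    p<n : p <ℕ n
    p<n = ℕₚ.≤∧≢⇒< (ℕₚ.≤-pred p<1+n) (n≢p ∘ ≡.sym)

  sumFin≡sum : ∀ {n} (f : Fin n → Carrier) → sumFin R f ≡ sum f
  sumFin≡sum {zero}  f = ≡.refl
  sumFin≡sum {suc n} f = ≡.cong (f zero +_) (sumFin≡sum (f ∘ suc))

  sum-toℕ : ∀ n (h : ℕ → Carrier) → sum {n} (h ∘ toℕ) ≈ sumTo R h n
  sum-toℕ zero    h = refl
  sum-toℕ (suc n) h = trans (+-congˡ (sum-toℕ n (h ∘ suc))) (sym (sumTo-head h n))

  sum-zero : ∀ {n} {f : Fin n → Carrier} → (∀ i → f i ≈ 0#) → sum f ≈ 0#
  sum-zero {n} f≈0 = trans (sum-cong-≋ f≈0) (sum-replicate-zero n)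

  sum-select : ∀ {n} (f : Fin n → Carrier) p → (∀ j → j ≢ p → f j ≈ 0#) → sum f ≈ f p
  sum-select {suc n} f p f≈0 = begin
    sum f                          ≈⟨ sum-remove {i = p} f ⟩
    f p + sum (f ∘ punchIn p)      ≈⟨ +-congˡ (sum-zero (λ k → f≈0 (punchIn p k) (Finₚ.punchInᵢ≢i p k))) ⟩
    f p + 0#                       ≈⟨ +-identityʳ (f p) ⟩
    f p                            ∎

  sum-pair : ∀ {n} (f : Fin n → Carrier) {c d} → c ≢ d →
             (∀ j → j ≢ c → j ≢ d → f j ≈ 0#) → sum f ≈ f c + f d
  sum-pair {suc n} f {c} {d} c≢d f≈0 = begin
    sum f                          ≈⟨ sum-remove {i = c} f ⟩
    f c + sum (f ∘ punchIn c)      ≈⟨ +-congˡ (sum-select (f ∘ punchIn c) d′ rest≈0) ⟩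
    f c + f (punchIn c d′)         ≡⟨ ≡.cong (λ j → f c + f j) (Finₚ.punchIn-punchOut c≢d) ⟩
    f c + f d                      ∎
    where
    d′ = punchOut c≢d
    rest≈0 : ∀ k → k ≢ d′ → f (punchIn c k) ≈ 0#
    rest≈0 k k≢d′ = f≈0 (punchIn c k) (Finₚ.punchInᵢ≢i c k) λ eq →
      k≢d′ (Finₚ.punchIn-injective c k d′ (≡.trans eq (≡.sym (Finₚ.punchIn-punchOut c≢d))))

  -- Determinants

  Matrix : ℕ → Set ℓ₁
  Matrix n = Fin n → Fin n → Carrier

  minor : ∀ {n} → Matrix (suc n) → Fin (suc n) → Matrix n
  minor M j i k = M (suc i) (punchIn j k)

  laplaceTerm : ∀ {n} → Matrix (suc n) → Fin (suc n) → Carrier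
  laplaceTerm {n} M j = negOnePow R (toℕ j) * (M zero j * det R n (minor M j))

  det-expand : ∀ {n} (M : Matrix (suc n)) → det R (suc n) M ≈ sum (laplaceTerm M)
  det-expand M = reflexive (sumFin≡sum (laplaceTerm M))

  det-cong : ∀ n {M N : Matrix n} → (∀ i j → M i j ≈ N i j) → det R n M ≈ det R n N
  det-cong zero    M≈N = refl
  det-cong (suc n) {M} {N} M≈N = begin
    det R (suc n) M       ≈⟨ det-expand M ⟩
    sum (laplaceTerm M)   ≈⟨ sum-cong-≋ {suc n} {laplaceTerm M} {laplaceTerm N} (λ j →
                               *-congˡ (*-cong (M≈N zero j) (det-cong n (λ i k → M≈N (suc i) (punchIn j k))))) ⟩
    sum (laplaceTerm N)   ≈⟨ det-expand N ⟨
    det R (suc n) N       ∎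

  AgreeOff : ∀ {n} → Fin n → Matrix n → Matrix n → Set ℓ₂
  AgreeOff c M N = ∀ i j → j ≢ c → M i j ≈ N i j

  det-minor-agreeOff : ∀ n {M N : Matrix (suc n)} {c} → AgreeOff c M N → det R n (minor M c) ≈ det R n (minor N c)
  det-minor-agreeOff n {c = c} M≈N = det-cong n λ i k → M≈N (suc i) (punchIn c k) (Finₚ.punchInᵢ≢i c k)

  minor-agreeOff : ∀ {n} {M N : Matrix (suc n)} {j c} (j≢c : j ≢ c) →
                   AgreeOff c M N → AgreeOff (punchOut j≢c) (minor M j) (minor N j)
  minor-agreeOff {j = j} j≢c M≈N i k k≢c′ = M≈N (suc i) (punchIn j k) λ eq →
    k≢c′ (Finₚ.punchIn-injective j k _ (≡.trans eq (≡.sym (Finₚ.punchIn-punchOut j≢c))))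

  minor-column : ∀ {n} (M : Matrix (suc n)) {j c} (j≢c : j ≢ c) i →
                 minor M j i (punchOut j≢c) ≡ M (suc i) c
  minor-column M j≢c i = ≡.cong (M (suc i)) (Finₚ.punchIn-punchOut j≢c)

  det-linear-column : ∀ n {A B C : Matrix n} (c : Fin n) a b →
    AgreeOff c A C → AgreeOff c B C → (∀ i → C i c ≈ a * A i c + b * B i c) →
    det R n C ≈ a * det R n A + b * det R n B
  det-linear-column (suc n) {A} {B} {C} c a b A≈C B≈C C-c = begin
    det R (suc n) C                                          ≈⟨ det-expand C ⟩
    sum (laplaceTerm C)                                      ≈⟨ sum-cong-≋ {suc n} term ⟩
    sum (λ j → a * laplaceTerm A j + b * laplaceTerm B j)
      ≈⟨ ∑-distrib-+ (λ j → a * laplaceTerm A j) (λ j → b * laplaceTerm B j) ⟩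
    sum (λ j → a * laplaceTerm A j) + sum (λ j → b * laplaceTerm B j)
      ≈⟨ +-cong (sym (*-distribˡ-sum a (laplaceTerm A))) (sym (*-distribˡ-sum b (laplaceTerm B))) ⟩
    a * sum (laplaceTerm A) + b * sum (laplaceTerm B)
      ≈⟨ +-cong (*-congˡ (sym (det-expand A))) (*-congˡ (sym (det-expand B))) ⟩
    a * det R (suc n) A + b * det R (suc n) B                ∎
    where
    distribute-head : ∀ σ a b x y d → σ * ((a * x + b * y) * d) ≈ a * (σ * (x * d)) + b * (σ * (y * d))
    distribute-head = solve 6 (λ σ a b x y d →
      σ :* ((a :* x :+ b :* y) :* d) := a :* (σ :* (x :* d)) :+ b :* (σ :* (y :* d))) refl
    distribute-minor : ∀ σ x a b p q → σ * (x * (a * p + b * q)) ≈ a * (σ * (x * p)) + b * (σ * (x * q))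
    distribute-minor = solve 6 (λ σ x a b p q →
      σ :* (x :* (a :* p :+ b :* q)) := a :* (σ :* (x :* p)) :+ b :* (σ :* (x :* q))) refl
    term : ∀ j → laplaceTerm C j ≈ a * laplaceTerm A j + b * laplaceTerm B j
    term j with j Fin.≟ c
    ... | yes ≡.refl = begin
      σ * (C zero j * det R n (minor C j))
        ≈⟨ *-congˡ (*-cong (C-c zero) (sym (det-minor-agreeOff n A≈C))) ⟩
      σ * ((a * A zero j + b * B zero j) * det R n (minor A j))
        ≈⟨ distribute-head σ a b _ _ _ ⟩
      a * (σ * (A zero j * det R n (minor A j))) + b * (σ * (B zero j * det R n (minor A j)))
        ≈⟨ +-congˡ (*-congˡ (*-congˡ (*-congˡ (trans (det-minor-agreeOff n A≈C) (sym (det-minor-agreeOff n B≈C)))))) ⟩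
      a * (σ * (A zero j * det R n (minor A j))) + b * (σ * (B zero j * det R n (minor B j))) ∎
      where σ = negOnePow R (toℕ j)
    ... | no j≢c = begin
      σ * (C zero j * det R n (minor C j))
        ≈⟨ *-congˡ (*-cong (sym (A≈C zero j j≢c)) minor-linear) ⟩
      σ * (A zero j * (a * det R n (minor A j) + b * det R n (minor B j)))
        ≈⟨ distribute-minor σ _ a b _ _ ⟩
      a * (σ * (A zero j * det R n (minor A j))) + b * (σ * (A zero j * det R n (minor B j)))
        ≈⟨ +-congˡ (*-congˡ (*-congˡ (*-congʳ (trans (A≈C zero j j≢c) (sym (B≈C zero j j≢c)))))) ⟩
      a * (σ * (A zero j * det R n (minor A j))) + b * (σ * (B zero j * det R n (minor B j))) ∎
      where
      σ = negOnePow R (toℕ j)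
      c′ = punchOut j≢c
      minor-linear : det R n (minor C j) ≈ a * det R n (minor A j) + b * det R n (minor B j)
      minor-linear = det-linear-column n c′ a b (minor-agreeOff j≢c A≈C) (minor-agreeOff j≢c B≈C) λ i →
        trans (reflexive (minor-column C j≢c i))
          (trans (C-c (suc i)) (sym (+-cong (*-congˡ (reflexive (minor-column A j≢c i)))
                                            (*-congˡ (reflexive (minor-column B j≢c i))))))

  det-additive-column : ∀ n {A B C : Matrix n} (c : Fin n) →
    AgreeOff c A C → AgreeOff c B C → (∀ i → C i c ≈ A i c + B i c) →
    det R n C ≈ det R n A + det R n B
  det-additive-column n c A≈C B≈C C-c =
    trans (det-linear-column n c 1# 1# A≈C B≈C (λ i → trans (C-c i) (sym (+-cong (*-identityˡ _) (*-identityˡ _)))))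
          (+-cong (*-identityˡ _) (*-identityˡ _))

  -- The two Laplace terms along adjacent columns c, d have the same minor and opposite signs.
  det-adjacent-equal-columns : ∀ n (M : Matrix n) {c d} → Adjacent c d →
    (∀ i → M i c ≈ M i d) → det R n M ≈ 0#
  det-adjacent-equal-columns (suc n) M {c} {d} adj Mc≈Md = begin
    det R (suc n) M                         ≈⟨ det-expand M ⟩
    sum (laplaceTerm M)                     ≈⟨ sum-pair (laplaceTerm M) (adjacent⇒≢ adj) other≈0 ⟩
    laplaceTerm M c + laplaceTerm M d
      ≈⟨ +-congˡ (*-cong (reflexive (≡.cong (negOnePow R) adj)) (*-cong (sym (Mc≈Md zero)) minor-d≈minor-c)) ⟩
    σ * X + - σ * X                         ≈⟨ +-congˡ (sym (-‿distribˡ-* σ X)) ⟩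
    σ * X - σ * X                           ≈⟨ -‿inverseʳ (σ * X) ⟩
    0#                                      ∎
    where
    σ = negOnePow R (toℕ c)
    X = M zero c * det R n (minor M c)
    other≈0 : ∀ j → j ≢ c → j ≢ d → laplaceTerm M j ≈ 0#
    other≈0 j j≢c j≢d = trans (*-congˡ (trans (*-congˡ minor≈0) (zeroʳ _))) (zeroʳ _)
      where
      minor≈0 : det R n (minor M j) ≈ 0#
      minor≈0 = det-adjacent-equal-columns n (minor M j) (punchOut-adjacent j≢c j≢d adj) λ i →
        trans (reflexive (minor-column M j≢c i)) (trans (Mc≈Md (suc i)) (reflexive (≡.sym (minor-column M j≢d i))))
    minor-d≈minor-c : det R n (minor M d) ≈ det R n (minor M c)
    minor-d≈minor-c = det-cong n λ i k → entry i k (punchIn-adjacent c d k adj)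
      where
      entry : ∀ i k → punchIn c k ≡ punchIn d k ⊎ (punchIn c k ≡ d × punchIn d k ≡ c) →
              M (suc i) (punchIn d k) ≈ M (suc i) (punchIn c k)
      entry i k (inj₁ same) = reflexive (≡.cong (M (suc i)) (≡.sym same))
      entry i k (inj₂ (c↦d , d↦c)) =
        trans (reflexive (≡.cong (M (suc i)) d↦c)) (trans (Mc≈Md (suc i)) (reflexive (≡.cong (M (suc i)) (≡.sym c↦d))))

  replaceColumn : ∀ {n} → Matrix n → Fin n → (Fin n → Carrier) → Matrix n
  replaceColumn M c v i j with j Fin.≟ c
  ... | yes _ = v i
  ... | no  _ = M i j

  replaceColumn-same : ∀ {n} (M : Matrix n) c v i → replaceColumn M c v i c ≡ v i
  replaceColumn-same M c v i with c Fin.≟ c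
  ... | yes _   = ≡.refl
  ... | no  c≢c = ⊥-elim (c≢c ≡.refl)

  replaceColumn-other : ∀ {n} (M : Matrix n) {c j} v i → j ≢ c → replaceColumn M c v i j ≡ M i j
  replaceColumn-other M {c} {j} v i j≢c with j Fin.≟ c
  ... | yes j≡c = ⊥-elim (j≢c j≡c)
  ... | no  _   = ≡.refl

  swapColumns : ∀ {n} → Matrix n → Fin n → Fin n → Matrix n
  swapColumns M c d i j = M i (transpose c d j)

  replaceColumns : ∀ {n} → Matrix n → Fin n → Fin n → (Fin n → Carrier) → (Fin n → Carrier) → Matrix n
  replaceColumns M c d u v = replaceColumn (replaceColumn M d v) c u

  module _ {n} (M : Matrix n) {c d : Fin n} (c≢d : c ≢ d) where

    replaceColumns-first : ∀ u v i → replaceColumns M c d u v i c ≡ u i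
    replaceColumns-first u v = replaceColumn-same (replaceColumn M d v) c u

    replaceColumns-second : ∀ u v i → replaceColumns M c d u v i d ≡ v i
    replaceColumns-second u v i = ≡.trans (replaceColumn-other _ u i (c≢d ∘ ≡.sym)) (replaceColumn-same M d v i)

    replaceColumns-other : ∀ u v i {j} → j ≢ c → j ≢ d → replaceColumns M c d u v i j ≡ M i j
    replaceColumns-other u v i j≢c j≢d = ≡.trans (replaceColumn-other _ u i j≢c) (replaceColumn-other M v i j≢d)

    replaceColumns-pointwise : ∀ {u v} {N : Matrix n} → (∀ i → u i ≈ N i c) → (∀ i → v i ≈ N i d) →
      (∀ i j → j ≢ c → j ≢ d → M i j ≈ N i j) → ∀ i j → replaceColumns M c d u v i j ≈ N i j
    replaceColumns-pointwise {u} {v} {N} u≈ v≈ M≈ i j = by-cases (j Fin.≟ c) (j Fin.≟ d)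
      where
      P = replaceColumns M c d u v
      by-cases : Dec (j ≡ c) → Dec (j ≡ d) → P i j ≈ N i j
      by-cases (yes j≡c) _ = begin
        P i j ≡⟨ ≡.cong (P i) j≡c ⟩ P i c ≡⟨ replaceColumns-first u v i ⟩ u i ≈⟨ u≈ i ⟩ N i c ≡⟨ ≡.cong (N i) j≡c ⟨ N i j ∎
      by-cases (no _) (yes j≡d) = begin
        P i j ≡⟨ ≡.cong (P i) j≡d ⟩ P i d ≡⟨ replaceColumns-second u v i ⟩ v i ≈⟨ v≈ i ⟩ N i d ≡⟨ ≡.cong (N i) j≡d ⟨ N i j ∎
      by-cases (no j≢c) (no j≢d) = trans (reflexive (replaceColumns-other u v i j≢c j≢d)) (M≈ i j j≢c j≢d)

    det-replaceColumns-additiveˡ : ∀ u u′ v →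
      det R n (replaceColumns M c d (λ i → u i + u′ i) v)
        ≈ det R n (replaceColumns M c d u v) + det R n (replaceColumns M c d u′ v)
    det-replaceColumns-additiveˡ u u′ v = det-additive-column n c (agree u) (agree u′) λ i →
      reflexive (≡.trans (replaceColumns-first _ v i)
                         (≡.sym (≡.cong₂ _+_ (replaceColumns-first u v i) (replaceColumns-first u′ v i))))
      where
      agree : ∀ w → AgreeOff c (replaceColumns M c d w v) (replaceColumns M c d (λ i → u i + u′ i) v)
      agree w i j j≢c = reflexive (≡.trans (replaceColumn-other _ w i j≢c) (≡.sym (replaceColumn-other _ _ i j≢c)))

    det-replaceColumns-additiveʳ : ∀ u v v′ →
      det R n (replaceColumns M c d u (λ i → v i + v′ i))
        ≈ det R n (replaceColumns M c d u v) + det R n (replaceColumns M c d u v′)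
    det-replaceColumns-additiveʳ u v v′ = det-additive-column n d (agree v) (agree v′) λ i →
      reflexive (≡.trans (replaceColumns-second u _ i)
                         (≡.sym (≡.cong₂ _+_ (replaceColumns-second u v i) (replaceColumns-second u v′ i))))
      where
      agree : ∀ w → AgreeOff d (replaceColumns M c d u w) (replaceColumns M c d u (λ i → v i + v′ i))
      agree w i j j≢d = by-cases (j Fin.≟ c)
        where
        P = replaceColumns M c d u w
        Q = replaceColumns M c d u (λ i → v i + v′ i)
        by-cases : Dec (j ≡ c) → P i j ≈ Q i j
        by-cases (yes j≡c) = begin
          P i j ≡⟨ ≡.cong (P i) j≡c ⟩ P i c ≡⟨ replaceColumns-first u w i ⟩ u i
                ≡⟨ replaceColumns-first u _ i ⟨ Q i c ≡⟨ ≡.cong (Q i) j≡c ⟨ Q i j ∎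
        by-cases (no j≢c) = reflexive (≡.trans (replaceColumns-other u w i j≢c j≢d) (≡.sym (replaceColumns-other u _ i j≢c j≢d)))

  -- The matrix with M_c + M_d in both columns c and d has determinant 0; expanding it
  -- bilinearly leaves det (swapColumns M c d) + det M.
  det-swap-adjacent : ∀ n (M : Matrix n) {c d} → Adjacent c d →
    det R n (swapColumns M c d) + det R n M ≈ 0#
  det-swap-adjacent n M {c} {d} adj = begin
    det R n (swapColumns M c d) + det R n M
      ≈⟨ +-cong (det-cong n (replaceColumns-pointwise M c≢d (λ i → reflexive (≡.cong (M i) (≡.sym (transpose-matchˡ c d))))
                                          (λ i → reflexive (≡.cong (M i) (≡.sym (transpose-matchʳ c d))))
                                          (λ i j j≢c j≢d → reflexive (≡.cong (M i) (≡.sym (transpose-other j≢c j≢d))))))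
                (det-cong n (replaceColumns-pointwise M c≢d (λ _ → refl) (λ _ → refl) (λ _ _ _ _ → refl))) ⟨
    det R n (P Md Mc) + det R n (P Mc Md)
      ≈⟨ insert-zeros (equal-columns Mc) (equal-columns Md) ⟩
    (det R n (P Mc Mc) + det R n (P Mc Md)) + (det R n (P Md Mc) + det R n (P Md Md))
      ≈⟨ +-cong (det-replaceColumns-additiveʳ M c≢d Mc Mc Md) (det-replaceColumns-additiveʳ M c≢d Md Mc Md) ⟨
    det R n (P Mc s) + det R n (P Md s)
      ≈⟨ det-replaceColumns-additiveˡ M c≢d Mc Md s ⟨
    det R n (P s s)
      ≈⟨ equal-columns s ⟩
    0# ∎
    where
    c≢d = adjacent⇒≢ adj
    Mc Md s : Fin n → Carrier
    Mc i = M i c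
    Md i = M i d
    s i = Mc i + Md i
    P = replaceColumns M c d
    equal-columns : ∀ u → det R n (P u u) ≈ 0#
    equal-columns u = det-adjacent-equal-columns n (P u u) adj λ i →
      reflexive (≡.trans (replaceColumns-first M c≢d u u i) (≡.sym (replaceColumns-second M c≢d u u i)))
    insert-zeros : ∀ {a b x y} → a ≈ 0# → y ≈ 0# → x + b ≈ (a + b) + (x + y)
    insert-zeros {a} {b} {x} {y} a≈0 y≈0 = sym (begin
      (a + b) + (x + y)   ≈⟨ +-cong (+-congʳ a≈0) (+-congˡ y≈0) ⟩
      (0# + b) + (x + 0#) ≈⟨ +-cong (+-identityˡ b) (+-identityʳ x) ⟩
      b + x               ≈⟨ +-comm b x ⟩
      x + b               ∎)

  -- Swapping d with its left neighbour e only changes the sign, and brings the copy of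
  -- column c one step closer.
  det-equal-columns-at-distance : ∀ k n (M : Matrix n) {c d} → toℕ d ≡ suc (toℕ c +ℕ k) →
    (∀ i → M i c ≈ M i d) → det R n M ≈ 0#
  det-equal-columns-at-distance zero    n M {c} d≡c+1 Mc≈Md =
    det-adjacent-equal-columns n M (≡.trans d≡c+1 (≡.cong suc (ℕₚ.+-identityʳ (toℕ c)))) Mc≈Md
  det-equal-columns-at-distance (suc k) n M {c} {d} d≡c+k+2 Mc≈Md = begin
    det R n M                                      ≈⟨ +-identityˡ _ ⟨
    0# + det R n M                                 ≈⟨ +-congʳ swapped≈0 ⟨
    det R n (swapColumns M e d) + det R n M        ≈⟨ det-swap-adjacent n M e-adjacent-d ⟩
    0#                                             ∎
    where
    d≡e+1 : toℕ d ≡ suc (suc (toℕ c +ℕ k))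
    d≡e+1 = ≡.trans d≡c+k+2 (≡.cong suc (ℕₚ.+-suc (toℕ c) k))
    e<n : suc (toℕ c +ℕ k) <ℕ n
    e<n = ≡.subst (_≤ℕ n) d≡e+1 (ℕₚ.<⇒≤ (Finₚ.toℕ<n d))
    e : Fin n
    e = fromℕ< e<n
    e-adjacent-d : Adjacent e d
    e-adjacent-d = ≡.trans d≡e+1 (≡.cong suc (≡.sym (Finₚ.toℕ-fromℕ< e<n)))
    c<e : toℕ c <ℕ toℕ e
    c<e = ≡.subst (toℕ c <ℕ_) (≡.sym (Finₚ.toℕ-fromℕ< e<n)) (s≤s (ℕₚ.m≤m+n (toℕ c) k))
    c≢e : c ≢ e
    c≢e = ℕₚ.<⇒≢ c<e ∘ ≡.cong toℕ
    c≢d : c ≢ d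
    c≢d = ℕₚ.<⇒≢ (ℕₚ.<-trans c<e (≡.subst (toℕ e <ℕ_) (≡.sym e-adjacent-d) ℕₚ.≤-refl)) ∘ ≡.cong toℕ
    swapped≈0 : det R n (swapColumns M e d) ≈ 0#
    swapped≈0 = det-equal-columns-at-distance k n (swapColumns M e d) (Finₚ.toℕ-fromℕ< e<n) λ i → begin
      M i (transpose e d c)   ≡⟨ ≡.cong (M i) (transpose-other c≢e c≢d) ⟩
      M i c                   ≈⟨ Mc≈Md i ⟩
      M i d                   ≡⟨ ≡.cong (M i) (transpose-matchˡ e d) ⟨
      M i (transpose e d e)   ∎

  det-equal-columns : ∀ n (M : Matrix n) {c d} → c ≢ d → (∀ i → M i c ≈ M i d) → det R n M ≈ 0#
  det-equal-columns n M {c} {d} c≢d Mc≈Md with ℕₚ.<-cmp (toℕ c) (toℕ d)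
  ... | tri< c<d _ _ = det-equal-columns-at-distance _ n M (≡.sym (proj₂ (ℕₚ.m≤n⇒∃[o]m+o≡n c<d))) Mc≈Md
  ... | tri≈ _ c≡d _ = ⊥-elim (c≢d (Finₚ.toℕ-injective c≡d))
  ... | tri> _ _ d<c = det-equal-columns-at-distance _ n M (≡.sym (proj₂ (ℕₚ.m≤n⇒∃[o]m+o≡n d<c))) (sym ∘ Mc≈Md)

  det-add-column-multiple : ∀ n {M M′ : Matrix n} {c d} a → d ≢ c → AgreeOff c M′ M →
    (∀ i → M′ i c ≈ M i c + a * M i d) → det R n M′ ≈ det R n M
  det-add-column-multiple n {M} {M′} {c} {d} a d≢c M′≈M M′-c = begin
    det R n M′                            ≈⟨ det-linear-column n c 1# a (λ i j j≢c → sym (M′≈M i j j≢c)) B≈M′ M′-c′ ⟩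
    1# * det R n M + a * det R n B        ≈⟨ +-cong (*-identityˡ _) (trans (*-congˡ B≈0) (zeroʳ a)) ⟩
    det R n M + 0#                        ≈⟨ +-identityʳ _ ⟩
    det R n M                             ∎
    where
    B = replaceColumn M c (λ i → M i d)
    B≈M′ : AgreeOff c B M′
    B≈M′ i j j≢c = trans (reflexive (replaceColumn-other M _ i j≢c)) (sym (M′≈M i j j≢c))
    M′-c′ : ∀ i → M′ i c ≈ 1# * M i c + a * B i c
    M′-c′ i = trans (M′-c i) (+-cong (sym (*-identityˡ _)) (*-congˡ (reflexive (≡.sym (replaceColumn-same M c _ i)))))
    B≈0 : det R n B ≈ 0#
    B≈0 = det-equal-columns n B (d≢c ∘ ≡.sym) λ i →
      reflexive (≡.trans (replaceColumn-same M c _ i) (≡.sym (replaceColumn-other M _ i d≢c)))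

  det-add-column-combination : ∀ n {k} (σ : Fin k → Fin n) (a : Fin k → Carrier) {c} →
    (∀ l → σ l ≢ c) → ∀ {M M′ : Matrix n} → AgreeOff c M′ M →
    (∀ i → M′ i c ≈ M i c + sum (λ l → a l * M i (σ l))) → det R n M′ ≈ det R n M
  det-add-column-combination n {zero} σ a {c} _ {M} {M′} M′≈M M′-c = det-cong n λ i j → by-cases i j (j Fin.≟ c)
    where
    by-cases : ∀ i j → Dec (j ≡ c) → M′ i j ≈ M i j
    by-cases i j (yes j≡c) = begin
      M′ i j ≡⟨ ≡.cong (M′ i) j≡c ⟩ M′ i c ≈⟨ M′-c i ⟩ M i c + 0# ≈⟨ +-identityʳ _ ⟩ M i c ≡⟨ ≡.cong (M i) j≡c ⟨ M i j ∎
    by-cases i j (no j≢c) = M′≈M i j j≢c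
  det-add-column-combination n {suc k} σ a {c} σ≢c {M} {M′} M′≈M M′-c = begin
    det R n M′    ≈⟨ det-add-column-multiple n (a zero) (σ≢c zero) M′≈M″ M′-c″ ⟩
    det R n M″
      ≈⟨ det-add-column-combination n (σ ∘ suc) (a ∘ suc) (σ≢c ∘ suc) M″≈M (λ i → reflexive (replaceColumn-same M c _ i)) ⟩
    det R n M     ∎
    where
    rest : Fin n → Carrier
    rest i = sum (λ l → a (suc l) * M i (σ (suc l)))
    M″ = replaceColumn M c (λ i → M i c + rest i)
    M″≈M : AgreeOff c M″ M
    M″≈M i j j≢c = reflexive (replaceColumn-other M _ i j≢c)
    M′≈M″ : AgreeOff c M′ M″
    M′≈M″ i j j≢c = trans (M′≈M i j j≢c) (sym (M″≈M i j j≢c))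
    x+[y+z]≈[x+z]+y : ∀ x y z → x + (y + z) ≈ (x + z) + y
    x+[y+z]≈[x+z]+y = solve 3 (λ x y z → x :+ (y :+ z) := (x :+ z) :+ y) refl
    M′-c″ : ∀ i → M′ i c ≈ M″ i c + a zero * M″ i (σ zero)
    M′-c″ i = begin
      M′ i c                                           ≈⟨ M′-c i ⟩
      M i c + (a zero * M i (σ zero) + rest i)         ≈⟨ x+[y+z]≈[x+z]+y _ _ _ ⟩
      (M i c + rest i) + a zero * M i (σ zero)         ≡⟨ ≡.cong₂ (λ x y → x + a zero * y) (replaceColumn-same M c _ i)
                                                                   (replaceColumn-other M _ i (σ≢c zero)) ⟨
      M″ i c + a zero * M″ i (σ zero)                  ∎

  _·ᴹ_ : ∀ {n} → Matrix n → Matrix n → Matrix n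
  (M ·ᴹ U) i j = sum (λ m → M i m * U m j)

  private
    module Hybrid {m} (M U : Matrix (suc m)) (U-below≈0 : ∀ k j → toℕ j <ℕ toℕ k → U k j ≈ 0#)
                   (U-diag≈1 : ∀ j → U j j ≈ 1#) where
      n : ℕ
      n = suc m

      hybrid : ℕ → Matrix n
      hybrid t i j with toℕ j ℕ.<? t
      ... | yes _ = M i j
      ... | no  _ = (M ·ᴹ U) i j

      hybrid-< : ∀ {t} i j → toℕ j <ℕ t → hybrid t i j ≡ M i j
      hybrid-< {t} i j j<t with toℕ j ℕ.<? t
      ... | yes _   = ≡.refl
      ... | no  j≮t = ⊥-elim (j≮t j<t)

      hybrid-≮ : ∀ {t} i j → ¬ toℕ j <ℕ t → hybrid t i j ≡ (M ·ᴹ U) i j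
      hybrid-≮ {t} i j j≮t with toℕ j ℕ.<? t
      ... | yes j<t = ⊥-elim (j≮t j<t)
      ... | no  _   = ≡.refl

      -- Column t of M U is column t of M plus a combination of the columns before it.
      det-hybrid-step : ∀ t → t <ℕ n → det R n (hybrid t) ≈ det R n (hybrid (suc t))
      det-hybrid-step t t<n = det-add-column-combination n (punchIn c) a (Finₚ.punchInᵢ≢i c) agree column-c
        where
        c = fromℕ< t<n
        toℕc≡t : toℕ c ≡ t
        toℕc≡t = Finₚ.toℕ-fromℕ< t<n
        a : Fin _ → Carrier
        a l = U (punchIn c l) c
        agree : AgreeOff c (hybrid t) (hybrid (suc t))
        agree i j j≢c with ℕₚ.<-cmp (toℕ j) t
        ... | tri< j<t _ _ = reflexive (≡.trans (hybrid-< i j j<t) (≡.sym (hybrid-< i j (ℕₚ.m<n⇒m<1+n j<t))))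
        ... | tri≈ _ j≡t _ = ⊥-elim (j≢c (Finₚ.toℕ-injective (≡.trans j≡t (≡.sym toℕc≡t))))
        ... | tri> _ _ t<j = reflexive (≡.trans (hybrid-≮ i j (ℕₚ.<⇒≯ t<j)) (≡.sym (hybrid-≮ i j (ℕₚ.<⇒≱ t<j ∘ ℕₚ.≤-pred))))
        term : ∀ i l → M i (punchIn c l) * U (punchIn c l) c ≈ a l * hybrid (suc t) i (punchIn c l)
        term i l = by-cases (toℕ (punchIn c l) ℕ.<? suc t)
          where
          by-cases : Dec (toℕ (punchIn c l) <ℕ suc t) → M i (punchIn c l) * a l ≈ a l * hybrid (suc t) i (punchIn c l)
          by-cases (yes j<1+t) = trans (*-comm _ _) (*-congˡ (reflexive (≡.sym (hybrid-< i _ j<1+t))))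
          by-cases (no  j≮1+t) = trans (*-congˡ a≈0) (trans (zeroʳ _) (sym (trans (*-congʳ a≈0) (zeroˡ _))))
            where
            a≈0 : a l ≈ 0#
            a≈0 = U-below≈0 (punchIn c l) c (≡.subst (_<ℕ toℕ (punchIn c l)) (≡.sym toℕc≡t) (ℕₚ.≰⇒> (j≮1+t ∘ s≤s)))
        column-c : ∀ i → hybrid t i c ≈ hybrid (suc t) i c + sum (λ l → a l * hybrid (suc t) i (punchIn c l))
        column-c i = begin
          hybrid t i c                                               ≡⟨ hybrid-≮ i c (ℕₚ.<-irrefl toℕc≡t) ⟩
          sum (λ m → M i m * U m c)                                  ≈⟨ sum-remove {i = c} (λ m → M i m * U m c) ⟩
          M i c * U c c + sum (λ l → M i (punchIn c l) * U (punchIn c l) c)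
            ≈⟨ +-cong (trans (*-congˡ (U-diag≈1 c)) (*-identityʳ _)) (sum-cong-≋ (term i)) ⟩
          M i c + sum (λ l → a l * hybrid (suc t) i (punchIn c l))
            ≡⟨ ≡.cong (_+ sum (λ l → a l * hybrid (suc t) i (punchIn c l)))
                      (hybrid-< {suc t} i c (≡.subst (_<ℕ suc t) (≡.sym toℕc≡t) ℕₚ.≤-refl)) ⟨
          hybrid (suc t) i c + sum (λ l → a l * hybrid (suc t) i (punchIn c l)) ∎

      det-hybrid : ∀ t → t ≤ℕ n → det R n (hybrid t) ≈ det R n (M ·ᴹ U)
      det-hybrid zero    _     = det-cong n λ i j → reflexive (hybrid-≮ {0} i j λ ())
      det-hybrid (suc t) t<n = trans (sym (det-hybrid-step t t<n)) (det-hybrid t (ℕₚ.<⇒≤ t<n))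

      det-M·U≈det-M : det R n (M ·ᴹ U) ≈ det R n M
      det-M·U≈det-M = trans (sym (det-hybrid n ℕₚ.≤-refl)) (det-cong n λ i j → reflexive (hybrid-< i j (Finₚ.toℕ<n j)))

  det-*-upperUnitriangular : ∀ n (M U : Matrix n) → (∀ k j → toℕ j <ℕ toℕ k → U k j ≈ 0#) → (∀ j → U j j ≈ 1#) →
    det R n (M ·ᴹ U) ≈ det R n M
  det-*-upperUnitriangular zero    M U _         _        = refl
  det-*-upperUnitriangular (suc m) M U U-below≈0 U-diag≈1 = Hybrid.det-M·U≈det-M M U U-below≈0 U-diag≈1

  det-lowerTriangular : ∀ n (N : Matrix n) → (∀ i j → toℕ i <ℕ toℕ j → N i j ≈ 0#) →
    det R n N ≈ product (λ i → N i i)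
  det-lowerTriangular zero    N _         = refl
  det-lowerTriangular (suc n) N above≈0 = begin
    det R (suc n) N                                   ≈⟨ det-expand N ⟩
    sum (laplaceTerm N)                               ≈⟨ sum-select (laplaceTerm N) zero first-row≈0 ⟩
    1# * (N zero zero * det R n (minor N zero))       ≈⟨ *-identityˡ _ ⟩
    N zero zero * det R n (minor N zero)
      ≈⟨ *-congˡ (det-lowerTriangular n (minor N zero) (λ i j → above≈0 (suc i) (suc j) ∘ s≤s)) ⟩
    N zero zero * product (λ i → N (suc i) (suc i))   ∎
    where
    first-row≈0 : ∀ j → j ≢ zero → laplaceTerm N j ≈ 0#
    first-row≈0 zero    0≢0 = ⊥-elim (0≢0 ≡.refl)
    first-row≈0 (suc j) _   = trans (*-congˡ (trans (*-congʳ (above≈0 zero (suc j) (s≤s z≤n))) (zeroˡ _))) (zeroʳ _)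

  -- Weighted Motzkin paths and Hankel determinants

  -- motzkin w n k: Motzkin paths of length n from height 0 to height k, where level steps
  -- weigh 1 and a down step from height k + 1 weighs w k (the Stieltjes tableau of the
  -- J-fraction with all b's equal to 1 and λ_{k+1} = w k).
  motzkin : (ℕ → Carrier) → ℕ → ℕ → Carrier
  motzkin w zero    zero    = 1#
  motzkin w zero    (suc k) = 0#
  motzkin w (suc n) zero    = motzkin w n zero + w zero * motzkin w n 1
  motzkin w (suc n) (suc k) = (motzkin w n k + motzkin w n (suc k)) + w (suc k) * motzkin w n (suc (suc k))

  motzkin-above : ∀ w {n k} → n <ℕ k → motzkin w n k ≈ 0#
  motzkin-above w {zero}  {suc k} _ = refl
  motzkin-above w {suc n} {suc k} (s≤s n<k) = begin
    (motzkin w n k + motzkin w n (suc k)) + w (suc k) * motzkin w n (suc (suc k))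
      ≈⟨ +-cong (+-cong (motzkin-above w n<k) (motzkin-above w (ℕₚ.m<n⇒m<1+n n<k)))
                (*-congˡ (motzkin-above w (ℕₚ.m<n⇒m<1+n (ℕₚ.m<n⇒m<1+n n<k)))) ⟩
    (0# + 0#) + w (suc k) * 0#  ≈⟨ +-cong (+-identityʳ 0#) (zeroʳ _) ⟩
    0# + 0#                     ≈⟨ +-identityʳ 0# ⟩
    0#                          ∎

  motzkin-diagonal : ∀ w n → motzkin w n n ≈ 1#
  motzkin-diagonal w zero    = refl
  motzkin-diagonal w (suc n) = begin
    (motzkin w n n + motzkin w n (suc n)) + w (suc n) * motzkin w n (suc (suc n))
      ≈⟨ +-cong (+-cong (motzkin-diagonal w n) (motzkin-above w {n} ℕₚ.≤-refl))
                (*-congˡ (motzkin-above w {n} (ℕₚ.m<n⇒m<1+n ℕₚ.≤-refl))) ⟩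
    (1# + 0#) + w (suc n) * 0#  ≈⟨ +-cong (+-identityʳ 1#) (zeroʳ _) ⟩
    1# + 0#                     ≈⟨ +-identityʳ 1# ⟩
    1#                          ∎

  -- Split a path ending at height k + 1 at its last visit to height 0: an up step follows,
  -- then a path that stays at height ≥ 1, i.e. a path for the shifted weights.
  module _ (w : ℕ → Carrier) where
    private
      A = motzkin w
      B = motzkin (w ∘ suc)

    lastVisitSum : ℕ → ℕ → Carrier
    lastVisitSum n k = sumTo R (λ i → A i 0 * B (n ∸ suc i) k) n

    lastVisitSum-recurrence : ∀ n k →
      (lastVisitSum n k + lastVisitSum n (suc k)) + w (suc (suc k)) * lastVisitSum n (suc (suc k))
        ≈ sumTo R (λ i → A i 0 * B (suc (n ∸ suc i)) (suc k)) n
    lastVisitSum-recurrence n k = begin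
      (lastVisitSum n k + lastVisitSum n (suc k)) + w (suc (suc k)) * lastVisitSum n (suc (suc k))
        ≈⟨ +-cong (sym (sumTo-distrib-+ _ _ n)) (*-distribˡ-sumTo _ _ n) ⟩
      sumTo R (λ i → A i 0 * B (n ∸ suc i) k + A i 0 * B (n ∸ suc i) (suc k)) n
        + sumTo R (λ i → w (suc (suc k)) * (A i 0 * B (n ∸ suc i) (suc (suc k)))) n
        ≈⟨ sym (sumTo-distrib-+ _ _ n) ⟩
      sumTo R (λ i → (A i 0 * B (n ∸ suc i) k + A i 0 * B (n ∸ suc i) (suc k))
                       + w (suc (suc k)) * (A i 0 * B (n ∸ suc i) (suc (suc k)))) n
        ≈⟨ sumTo-cong n (λ i _ → factor (A i 0) _ _ _ _) ⟩
      sumTo R (λ i → A i 0 * B (suc (n ∸ suc i)) (suc k)) n ∎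
      where
      factor : ∀ a x y z t → (a * x + a * y) + z * (a * t) ≈ a * ((x + y) + z * t)
      factor = solve 5 (λ a x y z t → (a :* x :+ a :* y) :+ z :* (a :* t) := a :* ((x :+ y) :+ z :* t)) refl

    lastVisitSum-suc : ∀ n k → lastVisitSum (suc n) k ≈ A n 0 * B 0 k + sumTo R (λ i → A i 0 * B (suc (n ∸ suc i)) k) n
    lastVisitSum-suc n k = +-cong (*-congˡ (reflexive (≡.cong (λ t → B t k) (ℕₚ.n∸n≡0 n))))
      (sumTo-cong n (λ i i<n → *-congˡ (reflexive (≡.cong (λ t → B t k) (n∸m≡1+[n∸1+m] i<n)))))

    lastVisitSum-step : ∀ n → (∀ k → A n (suc k) ≈ lastVisitSum n k) → ∀ k → A (suc n) (suc k) ≈ lastVisitSum (suc n) k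
    lastVisitSum-step n A≈ zero = begin
      (A n 0 + A n 1) + w 1 * A n 2
        ≈⟨ +-cong (+-congˡ (A≈ 0)) (*-congˡ (A≈ 1)) ⟩
      (A n 0 + lastVisitSum n 0) + w 1 * lastVisitSum n 1
        ≈⟨ +-assoc _ _ _ ⟩
      A n 0 + (lastVisitSum n 0 + w 1 * lastVisitSum n 1)
        ≈⟨ +-cong (sym (*-identityʳ _)) (+-congˡ (*-distribˡ-sumTo _ _ n)) ⟩
      A n 0 * 1# + (lastVisitSum n 0 + sumTo R (λ i → w 1 * (A i 0 * B (n ∸ suc i) 1)) n)
        ≈⟨ +-congˡ (trans (sym (sumTo-distrib-+ _ _ n)) (sumTo-cong n (λ i _ → factor (A i 0) _ (w 1) _))) ⟩
      A n 0 * 1# + sumTo R (λ i → A i 0 * B (suc (n ∸ suc i)) 0) n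
        ≈⟨ lastVisitSum-suc n 0 ⟨
      lastVisitSum (suc n) 0 ∎
      where
      factor : ∀ a x z t → a * x + z * (a * t) ≈ a * (x + z * t)
      factor = solve 4 (λ a x z t → a :* x :+ z :* (a :* t) := a :* (x :+ z :* t)) refl
    lastVisitSum-step n A≈ (suc k) = begin
      (A n (suc k) + A n (suc (suc k))) + w (suc (suc k)) * A n (suc (suc (suc k)))
        ≈⟨ +-cong (+-cong (A≈ k) (A≈ (suc k))) (*-congˡ (A≈ (suc (suc k)))) ⟩
      (lastVisitSum n k + lastVisitSum n (suc k)) + w (suc (suc k)) * lastVisitSum n (suc (suc k))
        ≈⟨ lastVisitSum-recurrence n k ⟩
      sumTo R (λ i → A i 0 * B (suc (n ∸ suc i)) (suc k)) n
        ≈⟨ trans (+-congʳ (zeroʳ (A n 0))) (+-identityˡ _) ⟨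
      A n 0 * 0# + sumTo R (λ i → A i 0 * B (suc (n ∸ suc i)) (suc k)) n
        ≈⟨ lastVisitSum-suc n (suc k) ⟨
      lastVisitSum (suc n) (suc k) ∎

  motzkin-lastVisit : ∀ w n k → motzkin w n (suc k) ≈ lastVisitSum w n k
  motzkin-lastVisit w zero    k = refl
  motzkin-lastVisit w (suc n) k = lastVisitSum-step w n (motzkin-lastVisit w n) k

  shiftUp : (ℕ → Carrier) → ℕ → Carrier
  shiftUp p zero    = 0#
  shiftUp p (suc m) = p m

  -- Coefficients of the monic orthogonal polynomials of the J-fraction:
  -- p₀ = 1, p₁ = x - 1, p_{j+2} = (x - 1) p_{j+1} - w j p_j.
  orthoPoly : (ℕ → Carrier) → ℕ → ℕ → Carrier
  orthoPoly w zero          = oneS R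
  orthoPoly w (suc zero)    m = shiftUp (oneS R) m - oneS R m
  orthoPoly w (suc (suc j)) m = (shiftUp (orthoPoly w (suc j)) m - orthoPoly w (suc j) m) - w j * orthoPoly w j m

  weightProduct : (ℕ → Carrier) → ℕ → Carrier
  weightProduct w zero    = 1#
  weightProduct w (suc j) = weightProduct w j * w j

  orthoPoly-above : ∀ w {j m} → j <ℕ m → orthoPoly w j m ≈ 0#
  orthoPoly-above w {zero}        {suc m}       _         = refl
  orthoPoly-above w {suc zero}    {suc zero}    (s≤s ())
  orthoPoly-above w {suc zero}    {suc (suc m)} _         = trans (+-congˡ -0#≈0#) (+-identityʳ 0#)
  orthoPoly-above w {suc (suc j)} {suc m}       (s≤s j<m) = begin
    (orthoPoly w (suc j) m - orthoPoly w (suc j) (suc m)) - w j * orthoPoly w j (suc m)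
      ≈⟨ +-cong (+-cong (orthoPoly-above w j<m) (-‿cong (orthoPoly-above w (ℕₚ.m<n⇒m<1+n j<m))))
                (-‿cong (*-congˡ (orthoPoly-above w (ℕₚ.m<n⇒m<1+n (ℕₚ.<-trans (ℕₚ.n<1+n j) j<m))))) ⟩
    (0# - 0#) - w j * 0#      ≈⟨ +-cong (-‿inverseʳ 0#) (-‿cong (zeroʳ (w j))) ⟩
    0# - 0#                   ≈⟨ -‿inverseʳ 0# ⟩
    0#                        ∎

  orthoPoly-leading : ∀ w j → orthoPoly w j j ≈ 1#
  orthoPoly-leading w zero          = refl
  orthoPoly-leading w (suc zero)    = trans (+-congˡ -0#≈0#) (+-identityʳ 1#)
  orthoPoly-leading w (suc (suc j)) = begin
    (orthoPoly w (suc j) (suc j) - orthoPoly w (suc j) (suc (suc j))) - w j * orthoPoly w j (suc (suc j))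
      ≈⟨ +-cong (+-cong (orthoPoly-leading w (suc j)) (-‿cong (orthoPoly-above w {suc j} ℕₚ.≤-refl)))
                (-‿cong (*-congˡ (orthoPoly-above w {j} (ℕₚ.m<n⇒m<1+n ℕₚ.≤-refl)))) ⟩
    (1# - 0#) - w j * 0#      ≈⟨ +-cong (trans (+-congˡ -0#≈0#) (+-identityʳ 1#)) (trans (-‿cong (zeroʳ (w j))) -0#≈0#) ⟩
    1# + 0#                   ≈⟨ +-identityʳ 1# ⟩
    1#                        ∎

  -- the moment functional of g applied to x^k p, truncated to the first N coefficients of p
  momentSum : (ℕ → Carrier) → ℕ → ℕ → (ℕ → Carrier) → Carrier
  momentSum g N k p = sumTo R (λ m → g (k +ℕ m) * p m) N

  momentSum-shiftUp : ∀ g N k p → momentSum g (suc N) k (shiftUp p) ≈ momentSum g N (suc k) p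
  momentSum-shiftUp g N k p = begin
    momentSum g (suc N) k (shiftUp p)                         ≈⟨ sumTo-head _ N ⟩
    g (k +ℕ 0) * 0# + sumTo R (λ m → g (k +ℕ suc m) * p m) N
      ≈⟨ +-cong (zeroʳ _) (sumTo-cong N (λ m _ → *-congʳ (reflexive (≡.cong g (ℕₚ.+-suc k m))))) ⟩
    0# + momentSum g N (suc k) p                              ≈⟨ +-identityˡ _ ⟩
    momentSum g N (suc k) p                                   ∎

  momentSum-oneS : ∀ g N k → 0 <ℕ N → momentSum g N k (oneS R) ≈ g k
  momentSum-oneS g N k 0<N = begin
    momentSum g N k (oneS R)  ≈⟨ sumTo-select N 0 0<N higher≈0 ⟩
    g (k +ℕ 0) * 1#           ≈⟨ *-identityʳ _ ⟩
    g (k +ℕ 0)                ≡⟨ ≡.cong g (ℕₚ.+-identityʳ k) ⟩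
    g k                       ∎
    where
    higher≈0 : ∀ m → m <ℕ N → m ≢ 0 → g (k +ℕ m) * oneS R m ≈ 0#
    higher≈0 zero    _ 0≢0 = ⊥-elim (0≢0 ≡.refl)
    higher≈0 (suc m) _ _   = zeroʳ _

  momentSum-sub : ∀ g N k p q → momentSum g N k (λ m → p m - q m) ≈ momentSum g N k p - momentSum g N k q
  momentSum-sub g N k p q = begin
    momentSum g N k (λ m → p m - q m)                                       ≈⟨ sumTo-cong N (λ m _ → x[y-z]≈xy-xz _ _ _) ⟩
    sumTo R (λ m → g (k +ℕ m) * p m + - (g (k +ℕ m) * q m)) N               ≈⟨ sumTo-distrib-+ _ _ N ⟩
    momentSum g N k p + sumTo R (λ m → - (g (k +ℕ m) * q m)) N              ≈⟨ +-congˡ (-‿distrib-sumTo _ N) ⟨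
    momentSum g N k p - momentSum g N k q                                   ∎

  momentSum-scale : ∀ g N k a p → momentSum g N k (λ m → a * p m) ≈ a * momentSum g N k p
  momentSum-scale g N k a p = begin
    momentSum g N k (λ m → a * p m)               ≈⟨ sumTo-cong N (λ m _ → x[ay]≈a[xy] _ a _) ⟩
    sumTo R (λ m → a * (g (k +ℕ m) * p m)) N      ≈⟨ *-distribˡ-sumTo a _ N ⟨
    a * momentSum g N k p                         ∎
    where
    x[ay]≈a[xy] : ∀ x a y → x * (a * y) ≈ a * (x * y)
    x[ay]≈a[xy] = solve 3 (λ x a y → x :* (a :* y) := a :* (x :* y)) refl

  -- The three-term recurrence of p_j mirrors the recurrence of motzkin.
  momentSum-orthoPoly : ∀ w g → (∀ k → g k ≈ motzkin w k 0) →
    ∀ j N k → j <ℕ N → momentSum g N k (orthoPoly w j) ≈ weightProduct w j * motzkin w k j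
  momentSum-orthoPoly w g g≈ zero N k 0<N = begin
    momentSum g N k (oneS R)   ≈⟨ momentSum-oneS g N k 0<N ⟩
    g k                        ≈⟨ g≈ k ⟩
    motzkin w k 0              ≈⟨ *-identityˡ _ ⟨
    1# * motzkin w k 0         ∎
  momentSum-orthoPoly w g g≈ (suc zero) (suc N) k (s≤s 0<N) = begin
    momentSum g (suc N) k (λ m → shiftUp (oneS R) m - oneS R m)
      ≈⟨ momentSum-sub g (suc N) k _ _ ⟩
    momentSum g (suc N) k (shiftUp (oneS R)) - momentSum g (suc N) k (oneS R)
      ≈⟨ +-cong (trans (momentSum-shiftUp g N k _) (momentSum-oneS g N (suc k) 0<N))
                (-‿cong (momentSum-oneS g (suc N) k (s≤s z≤n))) ⟩
    g (suc k) - g k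
      ≈⟨ +-cong (g≈ (suc k)) (-‿cong (g≈ k)) ⟩
    (motzkin w k 0 + w 0 * motzkin w k 1) - motzkin w k 0
      ≈⟨ +-congʳ (+-comm _ _) ⟩
    (w 0 * motzkin w k 1 + motzkin w k 0) - motzkin w k 0
      ≈⟨ //-rightDividesʳ (motzkin w k 0) _ ⟩
    w 0 * motzkin w k 1
      ≈⟨ *-congʳ (*-identityˡ (w 0)) ⟨
    (1# * w 0) * motzkin w k 1 ∎
  momentSum-orthoPoly w g g≈ (suc (suc j)) (suc N) k (s≤s j+1<N) = begin
    momentSum g (suc N) k (λ m → (shiftUp p₁ m - p₁ m) - w j * p₀ m)
      ≈⟨ momentSum-sub g (suc N) k _ _ ⟩
    momentSum g (suc N) k (λ m → shiftUp p₁ m - p₁ m) - momentSum g (suc N) k (λ m → w j * p₀ m)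
      ≈⟨ +-cong (momentSum-sub g (suc N) k _ _) (-‿cong (momentSum-scale g (suc N) k (w j) p₀)) ⟩
    (momentSum g (suc N) k (shiftUp p₁) - momentSum g (suc N) k p₁) - w j * momentSum g (suc N) k p₀
      ≈⟨ +-cong (+-cong (trans (momentSum-shiftUp g N k p₁) (momentSum-orthoPoly w g g≈ (suc j) N (suc k) j+1<N))
                        (-‿cong (momentSum-orthoPoly w g g≈ (suc j) (suc N) k (ℕₚ.m<n⇒m<1+n j+1<N))))
                (-‿cong (*-congˡ (momentSum-orthoPoly w g g≈ j (suc N) k (ℕₚ.<-trans (ℕₚ.n<1+n j) (ℕₚ.m<n⇒m<1+n j+1<N))))) ⟩
    (Λ₁ * A (suc k) (suc j) - Λ₁ * A k (suc j)) - w j * (Λ₀ * A k j)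
      ≡⟨⟩
    (Λ₁ * ((A k j + A k (suc j)) + w (suc j) * A k (suc (suc j))) - Λ₁ * A k (suc j)) - w j * (Λ₀ * A k j)
      ≈⟨ +-congʳ (+-congʳ (expand Λ₀ (w j) (w (suc j)) (A k j) (A k (suc j)) (A k (suc (suc j))))) ⟩
    ((Λ₂ * A k (suc (suc j)) + w j * (Λ₀ * A k j)) + Λ₁ * A k (suc j) - Λ₁ * A k (suc j)) - w j * (Λ₀ * A k j)
      ≈⟨ +-congʳ (//-rightDividesʳ (Λ₁ * A k (suc j)) _) ⟩
    (Λ₂ * A k (suc (suc j)) + w j * (Λ₀ * A k j)) - w j * (Λ₀ * A k j)
      ≈⟨ //-rightDividesʳ (w j * (Λ₀ * A k j)) _ ⟩
    Λ₂ * A k (suc (suc j)) ∎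
    where
    A = motzkin w
    p₀ = orthoPoly w j
    p₁ = orthoPoly w (suc j)
    Λ₀ = weightProduct w j
    Λ₁ = weightProduct w (suc j)
    Λ₂ = weightProduct w (suc (suc j))
    expand : ∀ λ₀ v v′ a b c → ((λ₀ * v) * ((a + b) + v′ * c)) ≈ (((λ₀ * v) * v′) * c + v * (λ₀ * a)) + (λ₀ * v) * b
    expand = solve 6 (λ λ₀ v v′ a b c → (λ₀ :* v) :* ((a :+ b) :+ v′ :* c)
                                     := (((λ₀ :* v) :* v′) :* c :+ v :* (λ₀ :* a)) :+ (λ₀ :* v) :* b) refl

  hankelProduct : (ℕ → Carrier) → ℕ → Carrier
  hankelProduct w n = product {n} (λ j → weightProduct w (toℕ j))

  hankelProduct-suc : ∀ w n → hankelProduct w (suc n) ≈ hankelProduct w n * weightProduct w n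
  hankelProduct-suc w n = begin
    hankelProduct w (suc n)                                       ≈⟨ product-init-last {n} (λ j → weightProduct w (toℕ j)) ⟩
    product {n} (λ j → weightProduct w (toℕ (Fin.inject₁ j))) * weightProduct w (toℕ (Fin.fromℕ n))
      ≡⟨ ≡.cong₂ _*_ (product-cong-≗ {n} (λ j → ≡.cong (weightProduct w) (Finₚ.toℕ-inject₁ j)))
                     (≡.cong (weightProduct w) (Finₚ.toℕ-fromℕ n)) ⟩
    hankelProduct w n * weightProduct w n                         ∎

  -- Column operations turn the Hankel matrix into (⟨x^i p_j⟩)_{ij}, which is lower triangular.
  hankel-motzkin : ∀ w g → (∀ k → g k ≈ motzkin w k 0) →
    ∀ n → Hankel R n g ≈ hankelProduct w n
  hankel-motzkin w g g≈ n = begin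
    det R n G                         ≈⟨ det-*-upperUnitriangular n G P P-below P-diagonal ⟨
    det R n (G ·ᴹ P)                  ≈⟨ det-lowerTriangular n (G ·ᴹ P) GP-above ⟩
    product {n} (λ j → (G ·ᴹ P) j j)
      ≈⟨ product-cong (λ j → trans (GP-entry j j) (trans (*-congˡ (motzkin-diagonal w (toℕ j))) (*-identityʳ _))) ⟩
    product {n} (λ j → weightProduct w (toℕ j)) ∎
    where
    G P : Matrix n
    G i j = g (toℕ i +ℕ toℕ j)
    P m j = orthoPoly w (toℕ j) (toℕ m)
    P-below : ∀ m j → toℕ j <ℕ toℕ m → P m j ≈ 0#
    P-below m j = orthoPoly-above w
    P-diagonal : ∀ j → P j j ≈ 1#
    P-diagonal j = orthoPoly-leading w (toℕ j)
    GP-entry : ∀ i j → (G ·ᴹ P) i j ≈ weightProduct w (toℕ j) * motzkin w (toℕ i) (toℕ j)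
    GP-entry i j = trans (sum-toℕ n _) (momentSum-orthoPoly w g g≈ (toℕ j) n (toℕ i) (Finₚ.toℕ<n j))
    GP-above : ∀ i j → toℕ i <ℕ toℕ j → (G ·ᴹ P) i j ≈ 0#
    GP-above i j i<j = trans (GP-entry i j) (trans (*-congˡ (motzkin-above w i<j)) (zeroʳ _))

  -- The functional equation

  sumTo-convolution-comm : ∀ (f h : ℕ → Carrier) n →
    sumTo R (λ i → f i * h (n ∸ suc i)) n ≈ sumTo R (λ i → h i * f (n ∸ suc i)) n
  sumTo-convolution-comm f h n = begin
    sumTo R (λ i → f i * h (n ∸ suc i)) n                          ≈⟨ sumTo-reverse _ n ⟩
    sumTo R (λ i → f (n ∸ suc i) * h (n ∸ suc (n ∸ suc i))) n
      ≈⟨ sumTo-cong n (λ i i<n → trans (*-comm _ _) (*-congʳ (reflexive (≡.cong h (index i<n))))) ⟩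
    sumTo R (λ i → h i * f (n ∸ suc i)) n                          ∎
    where
    index : ∀ {i} → i <ℕ n → n ∸ suc (n ∸ suc i) ≡ i
    index {i} i<n = ≡.trans (≡.cong (n ∸_) (≡.sym (n∸m≡1+[n∸1+m] i<n))) (ℕₚ.m∸[m∸n]≡n (ℕₚ.<⇒≤ i<n))

  ⋆-comm : ∀ (A B : PS R) n → _⋆_ R A B n ≈ _⋆_ R B A n
  ⋆-comm A B n = sumTo-convolution-comm A B (suc n)

  IsMonomial : ℕ → PS R → Set ℓ₂
  IsMonomial p A = A p ≈ 1# × (∀ k → k ≢ p → A k ≈ 0#)

  ⋆-monomialˡ : ∀ {p A} → IsMonomial p A → ∀ B {n} → p ≤ℕ n → _⋆_ R A B n ≈ B (n ∸ p)
  ⋆-monomialˡ {p} {A} (Ap≈1 , A≈0) B {n} p≤n = begin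
    _⋆_ R A B n           ≈⟨ sumTo-select (suc n) p (s≤s p≤n) (λ k _ k≢p → trans (*-congʳ (A≈0 k k≢p)) (zeroˡ _)) ⟩
    A p * B (n ∸ p)       ≈⟨ *-congʳ Ap≈1 ⟩
    1# * B (n ∸ p)        ≈⟨ *-identityˡ _ ⟩
    B (n ∸ p)             ∎

  ⋆-monomialˡ-< : ∀ {p A} → IsMonomial p A → ∀ B {n} → n <ℕ p → _⋆_ R A B n ≈ 0#
  ⋆-monomialˡ-< (_ , A≈0) B n<p =
    sumTo-zero _ (λ k k≤n → trans (*-congʳ (A≈0 k (ℕₚ.<⇒≢ (ℕₚ.≤-<-trans (ℕₚ.≤-pred k≤n) n<p)))) (zeroˡ _))

  xS-monomial : IsMonomial 1 (xS R)
  xS-monomial = refl , λ where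
    zero          _   → refl
    (suc zero)    1≢1 → ⊥-elim (1≢1 ≡.refl)
    (suc (suc k)) _   → refl

  xS²-monomial : IsMonomial 2 (_⋆_ R (xS R) (xS R))
  xS²-monomial = ⋆-monomialˡ xS-monomial (xS R) {2} (s≤s z≤n) , λ where
    zero                _   → ⋆-monomialˡ-< xS-monomial (xS R) {0} (s≤s z≤n)
    (suc zero)          _   → ⋆-monomialˡ xS-monomial (xS R) {1} (s≤s z≤n)
    (suc (suc zero))    2≢2 → ⊥-elim (2≢2 ≡.refl)
    (suc (suc (suc k))) _   → ⋆-monomialˡ xS-monomial (xS R) {3 +ℕ k} (s≤s z≤n)

  module FunctionalEquation (r s : Carrier) (g : PS R) where

    numerator : PS R
    numerator = _⊕_ R (oneS R) (_·_ R r (xS R))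

    quotient : PS R
    quotient = _⋆_ R numerator (geoS R)

    denominator : PS R
    denominator = _⊖_ R (_⊖_ R (oneS R) (_⋆_ R quotient (xS R))) (_·_ R s (_⋆_ R (_⋆_ R (xS R) (xS R)) g))

    numerator-zero : numerator 0 ≈ 1#
    numerator-zero = trans (+-congˡ (zeroʳ r)) (+-identityʳ 1#)

    numerator-one : numerator 1 ≈ r
    numerator-one = trans (+-identityˡ _) (*-identityʳ r)

    numerator-high : ∀ k → numerator (suc (suc k)) ≈ 0#
    numerator-high k = trans (+-identityˡ _) (zeroʳ r)

    quotient-zero : quotient 0 ≈ 1#
    quotient-zero = trans (+-identityʳ _) (trans (*-identityʳ _) numerator-zero)

    quotient-suc : ∀ n → quotient (suc n) ≈ 1# + r
    quotient-suc n = begin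
      quotient (suc n)                                  ≈⟨ sumTo-head f (suc n) ⟩
      f 0 + sumTo R (λ k → f (suc k)) (suc n)           ≈⟨ +-congˡ (sumTo-head (λ k → f (suc k)) n) ⟩
      f 0 + (f 1 + sumTo R (λ k → f (suc (suc k))) n)
        ≈⟨ +-cong (term 0 numerator-zero)
                  (+-cong (term 1 numerator-one) (sumTo-zero {λ k → f (suc (suc k))} n (λ k _ → term (2 +ℕ k) (numerator-high k)))) ⟩
      1# + (r + 0#)                                     ≈⟨ +-congˡ (+-identityʳ r) ⟩
      1# + r                                            ∎
      where
      f : ℕ → Carrier
      f k = numerator k * 1#
      term : ∀ k {a} → numerator k ≈ a → f k ≈ a
      term k eq = trans (*-identityʳ _) eq

    quotient·x-zero : _⋆_ R quotient (xS R) 0 ≈ 0#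
    quotient·x-zero = trans (⋆-comm quotient (xS R) 0) (⋆-monomialˡ-< xS-monomial quotient {0} (s≤s z≤n))

    quotient·x-suc : ∀ n → _⋆_ R quotient (xS R) (suc n) ≈ quotient n
    quotient·x-suc n = trans (⋆-comm quotient (xS R) (suc n)) (⋆-monomialˡ xS-monomial quotient {suc n} (s≤s z≤n))

    x²g-< : ∀ n → n <ℕ 2 → _⋆_ R (_⋆_ R (xS R) (xS R)) g n ≈ 0#
    x²g-< n = ⋆-monomialˡ-< xS²-monomial g {n}

    x²g-suc-suc : ∀ m → _⋆_ R (_⋆_ R (xS R) (xS R)) g (suc (suc m)) ≈ g m
    x²g-suc-suc m = ⋆-monomialˡ xS²-monomial g {suc (suc m)} (s≤s (s≤s z≤n))

    denominator-zero : denominator 0 ≈ 1#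
    denominator-zero = begin
      (1# - _⋆_ R quotient (xS R) 0) - s * _⋆_ R (_⋆_ R (xS R) (xS R)) g 0
        ≈⟨ +-cong (+-congˡ (-‿cong quotient·x-zero)) (-‿cong (*-congˡ (x²g-< 0 (s≤s z≤n)))) ⟩
      (1# - 0#) - s * 0#         ≈⟨ +-cong (+-congˡ -0#≈0#) (trans (-‿cong (zeroʳ s)) -0#≈0#) ⟩
      (1# + 0#) + 0#             ≈⟨ trans (+-identityʳ _) (+-identityʳ 1#) ⟩
      1#                         ∎

    denominator-one : denominator 1 ≈ - 1#
    denominator-one = begin
      (0# - _⋆_ R quotient (xS R) 1) - s * _⋆_ R (_⋆_ R (xS R) (xS R)) g 1
        ≈⟨ +-cong (+-congˡ (-‿cong (trans (quotient·x-suc 0) quotient-zero))) (-‿cong (*-congˡ (x²g-< 1 ℕₚ.≤-refl))) ⟩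
      (0# - 1#) - s * 0#         ≈⟨ +-cong (+-identityˡ _) (trans (-‿cong (zeroʳ s)) -0#≈0#) ⟩
      - 1# + 0#                  ≈⟨ +-identityʳ _ ⟩
      - 1#                       ∎

    denominator-suc-suc : ∀ m → denominator (suc (suc m)) ≈ - ((1# + r) + s * g m)
    denominator-suc-suc m = begin
      (0# - _⋆_ R quotient (xS R) (suc (suc m))) - s * _⋆_ R (_⋆_ R (xS R) (xS R)) g (suc (suc m))
        ≈⟨ +-cong (+-cong refl (-‿cong (trans (quotient·x-suc (suc m)) (quotient-suc m)))) (-‿cong (*-congˡ (x²g-suc-suc m))) ⟩
      (0# - (1# + r)) - s * g m  ≈⟨ +-congʳ (+-identityˡ _) ⟩
      - (1# + r) - s * g m       ≈⟨ -‿+-comm _ _ ⟩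
      - ((1# + r) + s * g m)     ∎

    module _ (g·denominator≈1 : SatisfiesEq R r s g) where

      g-zero : g 0 ≈ 1#
      g-zero = begin
        g 0                              ≈⟨ *-identityʳ _ ⟨
        g 0 * 1#                         ≈⟨ *-congˡ denominator-zero ⟨
        g 0 * denominator 0              ≈⟨ +-identityʳ _ ⟨
        g 0 * denominator 0 + 0#         ≈⟨ g·denominator≈1 0 ⟩
        1#                               ∎

      g-suc : ∀ m → g (suc m) ≈ g m + sumTo R (λ k → g k * ((1# + r) + s * g (m ∸ suc k))) m
      g-suc m = x∙y⁻¹≈ε⇒x≈y _ _ (begin
        g (suc m) - (g m + T)                  ≈⟨ +-congˡ (-‿+-comm (g m) T) ⟨
        g (suc m) + (- g m + - T)              ≈⟨ +-cong leading (+-cong next rest) ⟩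
        g (suc m) * denominator (suc m ∸ suc m)
          + (g m * denominator (suc m ∸ m) + sumTo R (λ k → g k * denominator (suc m ∸ k)) m)
                                               ≈⟨ g·denominator≈1 (suc m) ⟩
        0#                                     ∎)
        where
        T = sumTo R (λ k → g k * ((1# + r) + s * g (m ∸ suc k))) m
        leading : g (suc m) ≈ g (suc m) * denominator (suc m ∸ suc m)
        leading = begin
          g (suc m)                              ≈⟨ *-identityʳ _ ⟨
          g (suc m) * 1#                         ≈⟨ *-congˡ denominator-zero ⟨
          g (suc m) * denominator 0              ≡⟨ ≡.cong (λ i → g (suc m) * denominator i) (ℕₚ.n∸n≡0 m) ⟨
          g (suc m) * denominator (m ∸ m)        ∎
        next : - g m ≈ g m * denominator (suc m ∸ m)
        next = begin
          - g m                                  ≈⟨ -‿cong (*-identityʳ _) ⟨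
          - (g m * 1#)                           ≈⟨ -‿distribʳ-* (g m) 1# ⟩
          g m * - 1#                             ≈⟨ *-congˡ denominator-one ⟨
          g m * denominator 1                    ≡⟨ ≡.cong (λ i → g m * denominator i) (ℕₚ.m+n∸n≡m 1 m) ⟨
          g m * denominator (suc m ∸ m)          ∎
        index : ∀ {k} → k <ℕ m → suc m ∸ k ≡ suc (suc (m ∸ suc k))
        index k<m = ≡.trans (n∸m≡1+[n∸1+m] (ℕₚ.m<n⇒m<1+n k<m)) (≡.cong suc (n∸m≡1+[n∸1+m] k<m))
        rest : - T ≈ sumTo R (λ k → g k * denominator (suc m ∸ k)) m
        rest = begin
          - T                                                        ≈⟨ -‿distrib-sumTo _ m ⟩
          sumTo R (λ k → - (g k * ((1# + r) + s * g (m ∸ suc k)))) m ≈⟨ sumTo-cong m (λ k k<m → begin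
            - (g k * ((1# + r) + s * g (m ∸ suc k)))      ≈⟨ -‿distribʳ-* (g k) _ ⟩
            g k * - ((1# + r) + s * g (m ∸ suc k))        ≈⟨ *-congˡ (denominator-suc-suc (m ∸ suc k)) ⟨
            g k * denominator (suc (suc (m ∸ suc k)))     ≡⟨ ≡.cong (λ i → g k * denominator i) (index k<m) ⟨
            g k * denominator (suc m ∸ k)                 ∎) ⟩
          sumTo R (λ k → g k * denominator (suc m ∸ k)) m           ∎

  alternate : Carrier → Carrier → ℕ → Carrier
  alternate a b zero    = a
  alternate a b (suc j) = alternate b a j

  motzkin-suc-zero : ∀ w n → motzkin w (suc n) 0 ≈
    motzkin w n 0 + w 0 * sumTo R (λ i → motzkin w i 0 * motzkin (w ∘ suc) (n ∸ suc i) 0) n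
  motzkin-suc-zero w n = +-congˡ (*-congˡ (motzkin-lastVisit w n 0))

  -- G is the J-fraction with weights r + s + 1, s, r + s + 1, s, …, and H its tail s, r + s + 1, ….
  module AlternatingFraction (r s : Carrier) where

    u : Carrier
    u = r + s + 1#

    G H : ℕ → Carrier
    G n = motzkin (alternate u s) n 0
    H n = motzkin (alternate s u) n 0

    u·H : ∀ n → u * H n ≈ (1# + r) + s * G n
    u·H zero    = trans (*-identityʳ u) (trans (rotate r s 1#) (+-congˡ (sym (*-identityʳ s))))
      where
      rotate : ∀ r s o → r + s + o ≈ (o + r) + s
      rotate = solve 3 (λ r s o → r :+ s :+ o := (o :+ r) :+ s) refl
    u·H (suc n) = begin
      u * H (suc n)                                         ≈⟨ *-congˡ (motzkin-suc-zero (alternate s u) n) ⟩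
      u * (H n + s * sumTo R (λ i → H i * G (n ∸ suc i)) n) ≈⟨ *-congˡ (+-congˡ (*-congˡ (sumTo-convolution-comm H G n))) ⟩
      u * (H n + s * C)                                     ≈⟨ regroup u (H n) s C ⟩
      u * H n + s * (u * C)                                 ≈⟨ +-congʳ (u·H n) ⟩
      ((1# + r) + s * G n) + s * (u * C)                    ≈⟨ collect (1# + r) s (G n) (u * C) ⟩
      (1# + r) + s * (G n + u * C)                          ≈⟨ +-congˡ (*-congˡ (motzkin-suc-zero (alternate u s) n)) ⟨
      (1# + r) + s * G (suc n)                              ∎
      where
      C = sumTo R (λ i → G i * H (n ∸ suc i)) n
      regroup : ∀ u h s c → u * (h + s * c) ≈ u * h + s * (u * c)
      regroup = solve 4 (λ u h s c → u :* (h :+ s :* c) := u :* h :+ s :* (u :* c)) refl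
      collect : ∀ a s x y → (a + s * x) + s * y ≈ a + s * (x + y)
      collect = solve 4 (λ a s x y → (a :+ s :* x) :+ s :* y := a :+ s :* (x :+ y)) refl

    G-suc : ∀ m → G (suc m) ≈ G m + sumTo R (λ k → G k * ((1# + r) + s * G (m ∸ suc k))) m
    G-suc m = begin
      G (suc m)                                               ≈⟨ motzkin-suc-zero (alternate u s) m ⟩
      G m + u * sumTo R (λ k → G k * H (m ∸ suc k)) m         ≈⟨ +-congˡ (*-distribˡ-sumTo u _ m) ⟩
      G m + sumTo R (λ k → u * (G k * H (m ∸ suc k))) m
        ≈⟨ +-congˡ (sumTo-cong m (λ k _ → trans (x[yz]≈y[xz] u (G k) _) (*-congˡ (u·H (m ∸ suc k))))) ⟩
      G m + sumTo R (λ k → G k * ((1# + r) + s * G (m ∸ suc k))) m ∎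
      where
      x[yz]≈y[xz] : ∀ x y z → x * (y * z) ≈ y * (x * z)
      x[yz]≈y[xz] = solve 3 (λ x y z → x :* (y :* z) := y :* (x :* z)) refl

    -- g and G satisfy the same recursion with the same initial value.
    solution : ∀ g → SatisfiesEq R r s g → ∀ n → g n ≈ G n
    solution g eq n = up-to n n ℕₚ.≤-refl
      where
      open FunctionalEquation r s g
      up-to : ∀ n k → k ≤ℕ n → g k ≈ G k
      up-to n       zero    _         = g-zero eq
      up-to (suc n) (suc k) (s≤s k≤n) = begin
        g (suc k)                                                    ≈⟨ g-suc eq k ⟩
        g k + sumTo R (λ j → g j * ((1# + r) + s * g (k ∸ suc j))) k
          ≈⟨ +-cong (earlier k≤n) (sumTo-cong k (λ j j<k →
               *-cong (earlier (ℕₚ.<⇒≤ (ℕₚ.<-≤-trans j<k k≤n)))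
                      (+-congˡ (*-congˡ (earlier (ℕₚ.≤-trans (ℕₚ.m∸n≤m k (suc j)) k≤n)))))) ⟩
        G k + sumTo R (λ j → G j * ((1# + r) + s * G (k ∸ suc j))) k ≈⟨ G-suc k ⟨
        G (suc k)                                                    ∎
        where
        earlier : ∀ {j} → j ≤ℕ n → g j ≈ G j
        earlier j≤n = up-to n _ j≤n

  -- The Somos-4 relation

  hankelProduct-somos4 : ∀ w c → (∀ K → w K * w (suc K) ≈ c) → IsSomos4 R 0# (c * c) (hankelProduct w)
  hankelProduct-somos4 w c consecutive (suc (suc (suc (suc (suc K))))) (s≤s (s≤s (s≤s (s≤s (s≤s _))))) = begin
    Π (5 +ℕ K) * Π (suc K)
      ≈⟨ *-congʳ (trans (Π-suc (4 +ℕ K)) (*-congʳ (trans (Π-suc (3 +ℕ K)) (*-congʳ (Π-suc (2 +ℕ K)))))) ⟩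
    (((Π (2 +ℕ K) * Λ (2 +ℕ K)) * Λ (3 +ℕ K)) * Λ (4 +ℕ K)) * Π (suc K)
      ≈⟨ *-congʳ (*-congʳ (*-congʳ (*-congʳ (Π-suc (suc K))))) ⟩
    ((((P * L) * (L * a)) * ((L * a) * b)) * (((L * a) * b) * d)) * P
      ≈⟨ rearrange P L a b d ⟩
    ((a * b) * (b * d)) * (((P * L) * (L * a)) * ((P * L) * (L * a)))
      ≈⟨ *-cong (*-cong (consecutive (suc K)) (consecutive (2 +ℕ K))) (sym (*-cong Π-3+K Π-3+K)) ⟩
    (c * c) * (Π (3 +ℕ K) * Π (3 +ℕ K))
      ≈⟨ +-identityˡ _ ⟨
    0# + (c * c) * (Π (3 +ℕ K) * Π (3 +ℕ K))
      ≈⟨ +-congʳ (zeroˡ _) ⟨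
    0# * (Π (4 +ℕ K) * Π (2 +ℕ K)) + (c * c) * (Π (3 +ℕ K) * Π (3 +ℕ K)) ∎
    where
    Π = hankelProduct w
    Λ = weightProduct w
    Π-suc = hankelProduct-suc w
    P = Π (suc K)
    L = Λ (suc K)
    a = w (suc K)
    b = w (2 +ℕ K)
    d = w (3 +ℕ K)
    Π-3+K : Π (3 +ℕ K) ≈ (P * L) * (L * a)
    Π-3+K = trans (Π-suc (2 +ℕ K)) (*-congʳ (Π-suc (suc K)))
    rearrange : ∀ P L a b d → ((((P * L) * (L * a)) * ((L * a) * b)) * (((L * a) * b) * d)) * P
                            ≈ ((a * b) * (b * d)) * (((P * L) * (L * a)) * ((P * L) * (L * a)))
    rearrange = solve 5 (λ P L a b d → ((((P :* L) :* (L :* a)) :* ((L :* a) :* b)) :* (((L :* a) :* b) :* d)) :* P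
                                     := ((a :* b) :* (b :* d)) :* (((P :* L) :* (L :* a)) :* ((P :* L) :* (L :* a)))) refl

  isSomos4-resp-≈ : ∀ {α β β′} {t t′ : ℕ → Carrier} → β ≈ β′ → (∀ n → t n ≈ t′ n) →
                  IsSomos4 R α β t → IsSomos4 R α β′ t′
  isSomos4-resp-≈ β≈β′ t≈t′ somos n 5≤n =
    trans (sym (*-cong (t≈t′ n) (t≈t′ (n ∸ 4))))
      (trans (somos n 5≤n) (+-cong (*-congˡ (*-cong (t≈t′ (n ∸ 1)) (t≈t′ (n ∸ 3))))
                                   (*-cong β≈β′ (*-cong (t≈t′ (n ∸ 2)) (t≈t′ (n ∸ 2))))))

  alternate-consecutive : ∀ a b K → alternate a b K * alternate a b (suc K) ≈ a * b
  alternate-consecutive a b zero    = refl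
  alternate-consecutive a b (suc K) = trans (alternate-consecutive b a K) (*-comm b a)

  hankel-solution : ∀ r s g → SatisfiesEq R r s g →
    ∀ n → Hankel R n g ≈ hankelProduct (alternate (r + s + 1#) s) n
  hankel-solution r s g eq = hankel-motzkin (alternate (r + s + 1#) s) g (AlternatingFraction.solution r s g eq)

corollary4 : {c ℓ : Level} (R : CommutativeRing c ℓ) →
    (r s : CommutativeRing.Carrier R) → (g : PS R) → SatisfiesEq R r s g →
    let open CommutativeRing R in
    IsSomos4 R 0# ((s * s) * ((r + s + 1#) * (r + s + 1#))) (λ n → Hankel R n g)
corollary4 R r s g eq =
  isSomos4-resp-≈ R (c·c≈s²u² (r + s + 1#) s) (λ n → sym (hankel-solution R r s g eq n))
    (hankelProduct-somos4 R (alternate R u s) (u * s) (alternate-consecutive R u s))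
  where
  open CommutativeRing R
  open import Algebra.Solver.Ring.NaturalCoefficients.Default commutativeSemiring using (solve; _:*_; _:=_)
  u = r + s + 1#
  c·c≈s²u² : ∀ u s → (u * s) * (u * s) ≈ (s * s) * (u * u)
  c·c≈s²u² = solve 2 (λ u s → (u :* s) :* (u :* s) := (s :* s) :* (u :* u)) refl
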